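{- Let $\Gamma$ be an abelian group, let $(G=(V,E),\psi)$ be a finite $\Gamma$-gain graph, and let $\mu$ be a symmetric polymatroidal function over $\Gamma$. If $\mu(\{\gamma\})\le1$ for every $\gamma\in\Gamma$, then the function $$\ell_\mu(F)=|V(F)|-c(F)+\mu(\langle\langle F\rangle\rangle)\qquad(F\subseteq E)$$ is monotone and submodular on $E$.
   Context: A $\Gamma$-gain graph: $G$ finite directed graph (loops, parallel edges allowed), $\psi:E\to\Gamma$, reversing an edge inverts its gain; the gain of a walk is the ordered product of edge gains with inverses for backward edges. For $F\subseteq E$: $V(F)$ = endvertices of $F$; $c(F)$ = number of connected components of $(V(F),F)$; $\langle\langle F\rangle\rangle$ = subgroup of $\Gamma$ generated by the gains of all closed walks (at any base vertex) using only edges of $F$. $\mu:2^\Gamma\to\mathbb{R}_{\ge0}$ is a symmetric polymatroidal function if $\mu(\emptyset)=0$, $\mu$ is monotone and submodular on subsets of $\Gamma$, $\mu(X)=\mu(\langle X\rangle)$ for nonempty $X$ (with $\langle X\rangle$ the generated subgroup), and $\mu(X)=\mu(\gamma X\gamma^{ -1})$ for nonempty $X$ and $\gamma\in\Gamma$. -}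

module Defs where

open import Level using (0ℓ)
open import Data.Nat using (ℕ; zero; suc)
open import Data.Bool using (Bool; true; false; _∧_; _∨_; not; if_then_else_)
open import Data.Fin using (Fin; zero; suc; _≟_; _<?_)
open import Data.Vec using (lookup; tabulate)
open import Data.Fin.Subset using (Subset; ∣_∣)
open import Data.Product using (Σ; ∃; _×_; _,_)
open import Data.Sum using (_⊎_)
open import Data.Empty using (⊥)
open import Relation.Nullary.Decidable using (⌊_⌋)
open import Relation.Binary using (Rel; IsTotalOrder)
open import Algebra.Bundles using (AbelianGroup; CommutativeRing)
open import Relation.Binary.PropositionalEquality using (_≡_)

anyFin : ∀ {k} → (Fin k → Bool) → Bool
anyFin {zero}  f = false
anyFin {suc k} f = f zero ∨ anyFin (λ i → f (suc i))

allFin : ∀ {k} → (Fin k → Bool) → Bool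
allFin {zero}  f = true
allFin {suc k} f = f zero ∧ allFin (λ i → f (suc i))

countFin : ∀ {k} → (Fin k → Bool) → ℕ
countFin {zero}  f = 0
countFin {suc k} f = (if f zero then 1 else 0) Data.Nat.+ countFin (λ i → f (suc i))

record GainGraph (Γ : AbelianGroup 0ℓ 0ℓ) : Set where
  open AbelianGroup Γ
  field
    n    : ℕ
    m    : ℕ
    tail : Fin m → Fin n
    head : Fin m → Fin n
    ψ    : Fin m → Carrier

module GroupSubsets (Γ : AbelianGroup 0ℓ 0ℓ) where
  open AbelianGroup Γ

  SubsetΓ : Set₁
  SubsetΓ = Carrier → Set

  ∅Γ : SubsetΓ
  ∅Γ _ = ⊥

  singleton : Carrier → SubsetΓ
  singleton γ x = x ≈ γ

  _⊆Γ_ : SubsetΓ → SubsetΓ → Set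
  X ⊆Γ Y = ∀ x → X x → Y x

  _∪Γ_ : SubsetΓ → SubsetΓ → SubsetΓ
  (X ∪Γ Y) x = X x ⊎ Y x

  _∩Γ_ : SubsetΓ → SubsetΓ → SubsetΓ
  (X ∩Γ Y) x = X x × Y x

  NonEmpty : SubsetΓ → Set
  NonEmpty X = ∃ λ x → X x

  conj : Carrier → SubsetΓ → SubsetΓ
  conj γ X x = ∃ λ y → X y × (x ≈ (γ ∙ y) ∙ γ ⁻¹)

  data ⟨_⟩ (X : SubsetΓ) : SubsetΓ where
    gen  : ∀ {x} → X x → ⟨ X ⟩ x
    unit : ⟨ X ⟩ ε
    inv  : ∀ {x} → ⟨ X ⟩ x → ⟨ X ⟩ (x ⁻¹)
    mul  : ∀ {x y} → ⟨ X ⟩ x → ⟨ X ⟩ y → ⟨ X ⟩ (x ∙ y)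
    resp : ∀ {x y} → x ≈ y → ⟨ X ⟩ x → ⟨ X ⟩ y

-- Totally ordered commutative rings (codomain of μ; ℝ is an instance)

record OrderedCommutativeRing : Set₁ where
  field
    commRing : CommutativeRing 0ℓ 0ℓ
  open CommutativeRing commRing public
  field
    _≤_         : Rel Carrier 0ℓ
    isTotalOrder : IsTotalOrder _≈_ _≤_
    +-mono-≤    : ∀ {x y} z → x ≤ y → (x + z) ≤ (y + z)
    *-nonneg    : ∀ {x y} → 0# ≤ x → 0# ≤ y → 0# ≤ (x * y)
    0≤1         : 0# ≤ 1#

  fromℕ : ℕ → Carrier
  fromℕ zero    = 0#
  fromℕ (suc k) = 1# + fromℕ k

module Polymatroidal (Γ : AbelianGroup 0ℓ 0ℓ) (R : OrderedCommutativeRing) where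
  open GroupSubsets Γ
  open AbelianGroup Γ using (Carrier)
  open OrderedCommutativeRing R using (_≤_; _+_; 0#) renaming (_≈_ to _≈R_; Carrier to RC)

  record IsSymmetricPolymatroidal (μ : SubsetΓ → RC) : Set₁ where
    field
      empty      : μ ∅Γ ≈R 0#
      nonneg     : ∀ X → 0# ≤ μ X
      monotone   : ∀ {X Y} → X ⊆Γ Y → μ X ≤ μ Y
      submodular : ∀ X Y → (μ (X ∪Γ Y) + μ (X ∩Γ Y)) ≤ (μ X + μ Y)
      generated  : ∀ X → NonEmpty X → μ X ≈R μ ⟨ X ⟩
      conjInv    : ∀ X → NonEmpty X → ∀ γ → μ X ≈R μ (conj γ X)

module GainGraphFunctions {Γ : AbelianGroup 0ℓ 0ℓ} (G : GainGraph Γ) where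
  open AbelianGroup Γ
  open GainGraph G
  open GroupSubsets Γ

  inF : Subset m → Fin m → Bool
  inF F e = lookup F e

  VF : Subset m → Subset n
  VF F = tabulate λ v → anyFin λ e → inF F e ∧ (⌊ tail e ≟ v ⌋ ∨ ⌊ head e ≟ v ⌋)

  adj : Subset m → Fin n → Fin n → Bool
  adj F u v = anyFin λ e → inF F e ∧
    ((⌊ tail e ≟ u ⌋ ∧ ⌊ head e ≟ v ⌋) ∨ (⌊ head e ≟ u ⌋ ∧ ⌊ tail e ≟ v ⌋))

  reach : Subset m → ℕ → Fin n → Fin n → Bool
  reach F zero    u v = ⌊ u ≟ v ⌋
  reach F (suc k) u v = reach F k u v ∨ anyFin (λ w → reach F k u w ∧ adj F w v)

  -- connected in the graph (V(F), F)   (paths have < n edges)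
  connected : Subset m → Fin n → Fin n → Bool
  connected F = reach F n

  -- c(F): number of connected components of (V(F), F), counted by their
  -- least vertex (a vertex of V(F) not connected to any smaller vertex)
  c : Subset m → ℕ
  c F = countFin λ v → lookup (VF F) v ∧ allFin (λ w → not ⌊ w <? v ⌋ ∨ not (connected F w v))

  data Walk (F : Subset m) (u : Fin n) : Fin n → Carrier → Set where
    [] : Walk F u u ε
    fwd : ∀ {w g} (e : Fin m) → inF F e ≡ true → tail e ≡ w →
          Walk F u w g → Walk F u (head e) (g ∙ ψ e)
    bwd : ∀ {w g} (e : Fin m) → inF F e ≡ true → head e ≡ w →
          Walk F u w g → Walk F u (tail e) (g ∙ (ψ e ⁻¹))

  ClosedGain : Subset m → SubsetΓ
  ClosedGain F g = ∃ λ u → Walk F u u g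

  ⟪_⟫ : Subset m → SubsetΓ
  ⟪ F ⟫ = ⟨ ClosedGain F ⟩

  module _ (R : OrderedCommutativeRing) where
    open OrderedCommutativeRing R using (fromℕ) renaming (Carrier to RC; _+_ to _+R_; _-_ to _-R_)

    ℓ : (SubsetΓ → RC) → Subset m → RC
    ℓ μ F = (fromℕ ∣ VF F ∣ -R fromℕ (c F)) +R μ ⟪ F ⟫

module Submission where

-- Let κ(F) be the number of components of the spanning graph (V, F). Counting V(F) and the
-- isolated vertices separately gives |V(F)| − c(F) = |V| − κ(F), so ℓ_μ(F) = |V| − κ(F) + μ⟪F⟫.
-- Add an edge e = th to F. If t and h lie in different components of F, then κ drops by one
-- and ⟪F⟫ does not change, since a closed walk crossing the bridge e must cross it back; so the
-- marginal of ℓ_μ is 1. Otherwise a walk from t to h in F closes a cycle of some gain γ, κ is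
-- unchanged, and ⟪F ∪ e⟫ is generated by ⟪F⟫ and γ; the marginal is the increase of μ, which
-- lies between 0 and μ{γ} ≤ 1 and, by submodularity of μ, shrinks as F grows (γ stays the
-- same). Hence the marginals of ℓ_μ are nonnegative and antitone, which on a finite ground
-- set is monotonicity and submodularity.

open import Defs
open import Level using (0ℓ)
open import Algebra.Bundles using (AbelianGroup)
open import Data.Bool using (Bool; true; false; _∧_; _∨_; not; if_then_else_)
import Data.Bool.Properties as Boolₚ
open import Data.Empty using (⊥; ⊥-elim)
open import Data.Fin as Fin using (Fin; zero; suc; _≟_; _<?_)
import Data.Fin.Properties as Finₚ
open Finₚ using (any?)
open import Data.Fin.Subset
  using (Subset; _⊆_; _∪_; _∩_; ∁; ⁅_⁆; _∈_; _∉_; ∣_∣; ⊤; outside; inside)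
  renaming (⊥ to ∅)
open import Data.Fin.Subset.Properties
  using (∪-identityʳ; ∪-assoc; ∪-abs-∩; ∩-assoc; ∩-idem; ∩-comm; ∩-identityʳ; ∩-distribˡ-∪;
         p∪∁p≡⊤; ⊆-antisym; ⊥⊆; p⊆p∪q; q⊆p∪q; x∈p∪q⁻; x∈p∪q⁺; x∈p∩q⁻; x∈⁅x⁆; x∈⁅y⁆⇒x≡y;
         x∈∁p⇒x∉p)
open import Data.Nat as Nat using (ℕ; zero; suc)
import Data.Nat.Properties as ℕₚ
open import Data.Product using (∃; _×_; _,_; proj₁; proj₂)
open import Data.Sum using (_⊎_; inj₁; inj₂; [_,_]′; map₂; swap)
open import Function using (id)
open import Data.Vec using ([]; _∷_; here; there; lookup; tabulate)
open import Data.Vec.Properties using ([]=⇒lookup; lookup⇒[]=; lookup∘tabulate)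
open import Relation.Nullary using (¬_; Dec; yes; no; _×-dec_)
open import Relation.Nullary.Decidable using (⌊_⌋)
open import Relation.Binary.PropositionalEquality as ≡ using (_≡_; _≢_; cong; cong₂; subst)
open import Relation.Binary using (IsTotalOrder; Poset; tri<; tri≈; tri>)

module FinBool where

  open ≡ using (refl; sym; trans)
  open Nat using (_+_; _≤_; _<_; s≤s; z≤n)

  ∨-true⁻ : ∀ {a b} → a ∨ b ≡ true → a ≡ true ⊎ b ≡ true
  ∨-true⁻ {true}  _ = inj₁ refl
  ∨-true⁻ {false} p = inj₂ p

  ∨-true⁺ˡ : ∀ {a} b → a ≡ true → a ∨ b ≡ true
  ∨-true⁺ˡ b refl = refl

  ∨-true⁺ʳ : ∀ a {b} → b ≡ true → a ∨ b ≡ true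
  ∨-true⁺ʳ true  _ = refl
  ∨-true⁺ʳ false p = p

  ∧-true⁻ : ∀ {a b} → a ∧ b ≡ true → a ≡ true × b ≡ true
  ∧-true⁻ {true} p = refl , p

  ∧-true⁺ : ∀ {a b} → a ≡ true → b ≡ true → a ∧ b ≡ true
  ∧-true⁺ refl refl = refl

  true≢false : ∀ {a} → a ≡ true → a ≢ false
  true≢false refl ()

  ⌊⌋-true⁻ : ∀ {A : Set} (a? : Dec A) → ⌊ a? ⌋ ≡ true → A
  ⌊⌋-true⁻ (yes a) _ = a

  ⌊⌋-true⁺ : ∀ {A : Set} (a? : Dec A) → A → ⌊ a? ⌋ ≡ true
  ⌊⌋-true⁺ (yes _) _ = refl
  ⌊⌋-true⁺ (no ¬a) a = ⊥-elim (¬a a)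

  anyFin⁻ : ∀ {k} (f : Fin k → Bool) → anyFin f ≡ true → ∃ λ i → f i ≡ true
  anyFin⁻ {suc k} f p with f zero in eq
  ... | true  = zero , eq
  ... | false = let i , q = anyFin⁻ (λ i → f (suc i)) p in suc i , q

  anyFin⁺ : ∀ {k} (f : Fin k → Bool) i → f i ≡ true → anyFin f ≡ true
  anyFin⁺ f zero    p = ∨-true⁺ˡ _ p
  anyFin⁺ f (suc i) p = ∨-true⁺ʳ (f zero) (anyFin⁺ (λ j → f (suc j)) i p)

  allFin⁻ : ∀ {k} (f : Fin k → Bool) → allFin f ≡ true → ∀ i → f i ≡ true
  allFin⁻ f p zero    = proj₁ (∧-true⁻ p)
  allFin⁻ f p (suc i) = allFin⁻ (λ j → f (suc j)) (proj₂ (∧-true⁻ p)) i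

  allFin⁺ : ∀ {k} (f : Fin k → Bool) → (∀ i → f i ≡ true) → allFin f ≡ true
  allFin⁺ {zero}  f p = refl
  allFin⁺ {suc k} f p = ∧-true⁺ (p zero) (allFin⁺ (λ j → f (suc j)) (λ j → p (suc j)))

  true⇔true⇒≡ : ∀ {a b} → (a ≡ true → b ≡ true) → (b ≡ true → a ≡ true) → a ≡ b
  true⇔true⇒≡ {true}  {true}  _ _ = refl
  true⇔true⇒≡ {false} {false} _ _ = refl
  true⇔true⇒≡ {true}  {false} a⇒b _ = sym (a⇒b refl)
  true⇔true⇒≡ {false} {true}  _ b⇒a = b⇒a refl

  least-witness : ∀ {k} (f : Fin k → Bool) {v} → f v ≡ true →
    ∃ λ a → f a ≡ true × ∀ {w} → w Fin.< a → f w ≡ false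
  least-witness {suc k} f {v} fv with f zero in f₀
  ... | true = zero , f₀ , λ ()
  least-witness {suc k} f {zero}  fv | false = ⊥-elim (true≢false fv f₀)
  least-witness {suc k} f {suc v} fv | false with least-witness (λ i → f (suc i)) fv
  ... | a , fa , below = suc a , fa , λ { {zero} _ → f₀ ; {suc w} (s≤s w<a) → below w<a }

  countFin-cong : ∀ {k} (f g : Fin k → Bool) → (∀ i → f i ≡ g i) → countFin f ≡ countFin g
  countFin-cong {zero}  f g p = refl
  countFin-cong {suc k} f g p =
    cong₂ (λ a b → (if a then 1 else 0) + b) (p zero) (countFin-cong _ _ (λ i → p (suc i)))

  countFin≤k : ∀ {k} (f : Fin k → Bool) → countFin f ≤ k
  countFin≤k {zero}  f = z≤n
  countFin≤k {suc k} f with f zero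
  ... | true  = s≤s (countFin≤k (λ i → f (suc i)))
  ... | false = ℕₚ.m≤n⇒m≤1+n (countFin≤k (λ i → f (suc i)))

  countFin-mono : ∀ {k} (f g : Fin k → Bool) → (∀ i → f i ≡ true → g i ≡ true) →
    countFin f ≤ countFin g
  countFin-mono {zero}  f g p = z≤n
  countFin-mono {suc k} f g p with f zero in f₀ | g zero in g₀
  ... | true  | true  = s≤s (countFin-mono _ _ (λ i → p (suc i)))
  ... | false | true  = ℕₚ.m≤n⇒m≤1+n (countFin-mono _ _ (λ i → p (suc i)))
  ... | false | false = countFin-mono _ _ (λ i → p (suc i))
  ... | true  | false = ⊥-elim (true≢false (p zero f₀) g₀)

  countFin-mono-< : ∀ {k} (f g : Fin k → Bool) → (∀ i → f i ≡ true → g i ≡ true) →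
    ∀ b → g b ≡ true → f b ≡ false → countFin f < countFin g
  countFin-mono-< f g p zero gb fb rewrite gb | fb = s≤s (countFin-mono _ _ (λ i → p (suc i)))
  countFin-mono-< f g p (suc b) gb fb with f zero in f₀ | g zero in g₀
  ... | true  | true  = s≤s (countFin-mono-< _ _ (λ i → p (suc i)) b gb fb)
  ... | false | true  = ℕₚ.m≤n⇒m≤1+n (countFin-mono-< _ _ (λ i → p (suc i)) b gb fb)
  ... | false | false = countFin-mono-< _ _ (λ i → p (suc i)) b gb fb
  ... | true  | false = ⊥-elim (true≢false (p zero f₀) g₀)

  countFin-pos : ∀ {k} (f : Fin k → Bool) i → f i ≡ true → 1 ≤ countFin f
  countFin-pos f zero p rewrite p = s≤s z≤n
  countFin-pos f (suc i) p with f zero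
  ... | true  = s≤s z≤n
  ... | false = countFin-pos (λ j → f (suc j)) i p

  countFin-drop : ∀ {k} (f g : Fin k → Bool) b → (∀ i → i ≢ b → f i ≡ g i) →
    f b ≡ true → g b ≡ false → countFin f ≡ suc (countFin g)
  countFin-drop f g zero p fb gb rewrite fb | gb =
    cong suc (countFin-cong _ _ (λ i → p (suc i) (λ ())))
  countFin-drop f g (suc b) p fb gb rewrite p zero (λ ()) with g zero
  ... | true  = cong suc (countFin-drop _ _ b p′ fb gb)
    where p′ = λ i i≢b → p (suc i) (λ q → i≢b (Finₚ.suc-injective q))
  ... | false = countFin-drop _ _ b p′ fb gb
    where p′ = λ i i≢b → p (suc i) (λ q → i≢b (Finₚ.suc-injective q))

  countFin-split : ∀ {k} (g f : Fin k → Bool) →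
    countFin f ≡ countFin (λ i → g i ∧ f i) + countFin (λ i → not (g i) ∧ f i)
  countFin-split {zero}  g f = refl
  countFin-split {suc k} g f with g zero | f zero
  ... | true  | true  = cong suc (countFin-split (λ i → g (suc i)) (λ i → f (suc i)))
  ... | true  | false = countFin-split (λ i → g (suc i)) (λ i → f (suc i))
  ... | false | true  = trans (cong suc (countFin-split (λ i → g (suc i)) (λ i → f (suc i))))
                              (sym (ℕₚ.+-suc _ _))
  ... | false | false = countFin-split (λ i → g (suc i)) (λ i → f (suc i))

  countFin-not : ∀ {k} (g : Fin k → Bool) → countFin (λ i → not (g i)) + countFin g ≡ k
  countFin-not {zero}  g = refl
  countFin-not {suc k} g with g zero
  ... | true  = trans (ℕₚ.+-suc _ _) (cong suc (countFin-not (λ i → g (suc i))))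
  ... | false = cong suc (countFin-not (λ i → g (suc i)))

  ∣tabulate∣ : ∀ {k} (f : Fin k → Bool) → ∣ tabulate f ∣ ≡ countFin f
  ∣tabulate∣ {zero}  f = refl
  ∣tabulate∣ {suc k} f with f zero
  ... | true  = cong suc (∣tabulate∣ (λ i → f (suc i)))
  ... | false = ∣tabulate∣ (λ i → f (suc i))

module OrderedCommutativeRingProperties (R : OrderedCommutativeRing) where

  open OrderedCommutativeRing R
  open IsTotalOrder isTotalOrder public using (antisym)
    renaming (refl to ≤-refl; trans to ≤-trans; reflexive to ≤-reflexive)
  open import Algebra.Solver.CommutativeMonoid +-commutativeMonoid using (solve; _⊜_; _⊕_)
  open import Algebra.Properties.AbelianGroup +-abelianGroup using (⁻¹-∙-comm)
  open import Algebra.Properties.Group +-group using (⁻¹-involutive)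

  ≤-poset : Poset 0ℓ 0ℓ 0ℓ
  ≤-poset = record { isPartialOrder = IsTotalOrder.isPartialOrder isTotalOrder }

  open import Relation.Binary.Reasoning.PartialOrder ≤-poset

  x+[y-y]≈x : ∀ x y → x + (y - y) ≈ x
  x+[y-y]≈x x y = trans (+-congˡ (-‿inverseʳ y)) (+-identityʳ x)

  +-monoˡ-≤ : ∀ z {x y} → x ≤ y → (z + x) ≤ (z + y)
  +-monoˡ-≤ z {x} {y} x≤y = begin
    z + x ≈⟨ +-comm z x ⟩
    x + z ≤⟨ +-mono-≤ z x≤y ⟩
    y + z ≈⟨ +-comm y z ⟩
    z + y ∎

  +-mono₂-≤ : ∀ {a b c d} → a ≤ b → c ≤ d → (a + c) ≤ (b + d)
  +-mono₂-≤ {b = b} {c} a≤b c≤d = ≤-trans (+-mono-≤ c a≤b) (+-monoˡ-≤ b c≤d)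

  -‿monoʳ-≤ : ∀ z {x y} → x ≤ y → (x - z) ≤ (y - z)
  -‿monoʳ-≤ z = +-mono-≤ (- z)

  x≈y⇒x-y≈0 : ∀ {x y} → x ≈ y → (x - y) ≈ 0#
  x≈y⇒x-y≈0 {x} {y} x≈y = trans (+-congʳ x≈y) (-‿inverseʳ y)

  x≤x+y : ∀ x {y} → 0# ≤ y → x ≤ (x + y)
  x≤x+y x {y} 0≤y = begin
    x      ≈⟨ sym (+-identityʳ x) ⟩
    x + 0# ≤⟨ +-monoˡ-≤ x 0≤y ⟩
    x + y  ∎

  x≤y⇒0≤y-x : ∀ {x y} → x ≤ y → 0# ≤ (y - x)
  x≤y⇒0≤y-x {x} {y} x≤y = begin
    0#    ≈⟨ sym (-‿inverseʳ x) ⟩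
    x - x ≤⟨ -‿monoʳ-≤ x x≤y ⟩
    y - x ∎

  x≤y+z⇒x-y≤z : ∀ {x y z} → x ≤ (y + z) → (x - y) ≤ z
  x≤y+z⇒x-y≤z {x} {y} {z} x≤y+z = begin
    x - y         ≤⟨ -‿monoʳ-≤ y x≤y+z ⟩
    y + z - y     ≈⟨ solve 3 (λ y z -y → ((y ⊕ z) ⊕ -y) ⊜ (z ⊕ (y ⊕ -y))) refl y z (- y) ⟩
    z + (y - y)   ≈⟨ x+[y-y]≈x z y ⟩
    z             ∎

  x+w≤z+y⇒x-y≤z-w : ∀ {x y z w} → (x + w) ≤ (z + y) → (x - y) ≤ (z - w)
  x+w≤z+y⇒x-y≤z-w {x} {y} {z} {w} le = begin
    x - y                 ≈⟨ sym (x+[y-y]≈x (x - y) w) ⟩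
    (x - y) + (w - w)
      ≈⟨ solve 4 (λ x -y w -w → ((x ⊕ -y) ⊕ (w ⊕ -w)) ⊜ (((x ⊕ w) ⊕ -w) ⊕ -y))
          refl x (- y) w (- w) ⟩
    x + w - w - y         ≤⟨ -‿monoʳ-≤ y (-‿monoʳ-≤ w le) ⟩
    z + y - w - y
      ≈⟨ solve 4 (λ z y -w -y → (((z ⊕ y) ⊕ -w) ⊕ -y) ⊜ ((z ⊕ -w) ⊕ (y ⊕ -y)))
          refl z y (- w) (- y) ⟩
    (z - w) + (y - y)     ≈⟨ x+[y-y]≈x (z - w) y ⟩
    z - w                 ∎

  x≤y∧0≤z-y⇒x≤z : ∀ {x y z} → x ≤ y → 0# ≤ (z - y) → x ≤ z
  x≤y∧0≤z-y⇒x≤z {x} {y} {z} x≤y 0≤z-y = begin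
    x            ≈⟨ sym (+-identityʳ x) ⟩
    x + 0#       ≤⟨ +-mono₂-≤ x≤y 0≤z-y ⟩
    y + (z - y)  ≈⟨ solve 3 (λ y z -y → (y ⊕ (z ⊕ -y)) ⊜ (z ⊕ (y ⊕ -y))) refl y z (- y) ⟩
    z + (y - y)  ≈⟨ x+[y-y]≈x z y ⟩
    z            ∎

  a+b≤c+d∧a′-a≤d′-d⇒a′+b≤c+d′ : ∀ {a a′ b c d d′} →
    (a + b) ≤ (c + d) → (a′ - a) ≤ (d′ - d) → (a′ + b) ≤ (c + d′)
  a+b≤c+d∧a′-a≤d′-d⇒a′+b≤c+d′ {a} {a′} {b} {c} {d} {d′} le Δle = begin
    a′ + b                ≈⟨ sym (x+[y-y]≈x (a′ + b) a) ⟩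
    (a′ + b) + (a - a)
      ≈⟨ solve 4 (λ a′ b a -a → ((a′ ⊕ b) ⊕ (a ⊕ -a)) ⊜ ((a ⊕ b) ⊕ (a′ ⊕ -a)))
          refl a′ b a (- a) ⟩
    (a + b) + (a′ - a)    ≤⟨ +-mono₂-≤ le Δle ⟩
    (c + d) + (d′ - d)
      ≈⟨ solve 4 (λ c d d′ -d → ((c ⊕ d) ⊕ (d′ ⊕ -d)) ⊜ ((c ⊕ d′) ⊕ (d ⊕ -d)))
          refl c d d′ (- d) ⟩
    (c + d′) + (d - d)    ≈⟨ x+[y-y]≈x (c + d′) d ⟩
    c + d′                ∎

  [a-b+c]-[a-d+e]≈[d-b]+[c-e] : ∀ a b c d e → ((a - b) + c) - ((a - d) + e) ≈ (d - b) + (c - e)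
  [a-b+c]-[a-d+e]≈[d-b]+[c-e] a b c d e = begin-equality
    ((a - b) + c) - ((a - d) + e)           ≈⟨ +-congˡ (sym (⁻¹-∙-comm (a - d) e)) ⟩
    ((a - b) + c) + (- (a - d) + - e)       ≈⟨ +-congˡ (+-congʳ (sym (⁻¹-∙-comm a (- d)))) ⟩
    ((a - b) + c) + ((- a + - - d) + - e)   ≈⟨ +-congˡ (+-congʳ (+-congˡ (⁻¹-involutive d))) ⟩
    ((a - b) + c) + ((- a + d) + - e)
      ≈⟨ solve 6 (λ a -b c -a d -e → (((a ⊕ -b) ⊕ c) ⊕ ((-a ⊕ d) ⊕ -e))
                                      ⊜ (((d ⊕ -b) ⊕ (c ⊕ -e)) ⊕ (a ⊕ -a)))
          refl a (- b) c (- a) d (- e) ⟩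
    ((d - b) + (c - e)) + (a - a)           ≈⟨ x+[y-y]≈x _ a ⟩
    (d - b) + (c - e)                       ∎

  fromℕ-+ : ∀ a b → fromℕ (a Nat.+ b) ≈ fromℕ a + fromℕ b
  fromℕ-+ zero    b = sym (+-identityˡ _)
  fromℕ-+ (suc a) b = trans (+-congˡ (fromℕ-+ a b)) (sym (+-assoc 1# _ _))

  fromℕ-cross : ∀ a b c d → a Nat.+ d ≡ b Nat.+ c →
    (fromℕ a - fromℕ b) ≈ (fromℕ c - fromℕ d)
  fromℕ-cross a b c d eq = begin-equality
    A - B                       ≈⟨ sym (x+[y-y]≈x (A - B) D) ⟩
    (A - B) + (D - D)
      ≈⟨ solve 4 (λ A -B D -D → ((A ⊕ -B) ⊕ (D ⊕ -D)) ⊜ (((A ⊕ D) ⊕ -B) ⊕ -D))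
          refl A (- B) D (- D) ⟩
    A + D - B - D               ≈⟨ +-congʳ (+-congʳ (sym (fromℕ-+ a d))) ⟩
    fromℕ (a Nat.+ d) - B - D   ≈⟨ +-congʳ (+-congʳ (reflexive (cong fromℕ eq))) ⟩
    fromℕ (b Nat.+ c) - B - D   ≈⟨ +-congʳ (+-congʳ (fromℕ-+ b c)) ⟩
    B + C - B - D
      ≈⟨ solve 4 (λ B C -B -D → (((B ⊕ C) ⊕ -B) ⊕ -D) ⊜ ((C ⊕ -D) ⊕ (B ⊕ -B)))
          refl B C (- B) (- D) ⟩
    (C - D) + (B - B)           ≈⟨ x+[y-y]≈x (C - D) B ⟩
    C - D                       ∎
    where A = fromℕ a; B = fromℕ b; C = fromℕ c; D = fromℕ d

Subset-ind : ∀ {m} (P : Subset m → Set) (D : Subset m) → P ∅ →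
  (∀ S e → e ∈ D → P S → P (S ∪ ⁅ e ⁆)) → P D
Subset-ind {zero}  P []            base step = base
Subset-ind {suc m} P (outside ∷ D) base step =
  Subset-ind (λ S → P (outside ∷ S)) D base (λ S e e∈D → step (outside ∷ S) (suc e) (there e∈D))
Subset-ind {suc m} P (inside ∷ D)  base step =
  subst (λ S → P (inside ∷ S)) (∪-identityʳ D) (step (outside ∷ D) zero here
    (Subset-ind (λ S → P (outside ∷ S)) D base
      (λ S e e∈D → step (outside ∷ S) (suc e) (there e∈D))))

p⊆q⇒p∪q≡q : ∀ {m} {p q : Subset m} → p ⊆ q → p ∪ q ≡ q
p⊆q⇒p∪q≡q {p = p} {q} p⊆q =
  ⊆-antisym (λ x∈p∪q → [ p⊆q , id ]′ (x∈p∪q⁻ p q x∈p∪q)) (q⊆p∪q p q)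

x∉p⇒p∩⁅x⁆≡∅ : ∀ {m} {x : Fin m} {p : Subset m} → x ∉ p → p ∩ ⁅ x ⁆ ≡ ∅
x∉p⇒p∩⁅x⁆≡∅ {x = x} {p} x∉p = ⊆-antisym y∈p∩⁅x⁆⇒⊥ ⊥⊆
  where
  y∈p∩⁅x⁆⇒⊥ : ∀ {y} → y ∈ p ∩ ⁅ x ⁆ → y ∈ ∅
  y∈p∩⁅x⁆⇒⊥ y∈ with x∈p∩q⁻ p ⁅ x ⁆ y∈
  ... | y∈p , y∈⁅x⁆ = ⊥-elim (x∉p (subst (_∈ p) (x∈⁅y⁆⇒x≡y x y∈⁅x⁆) y∈p))

x∈p∪⁅y⁆⁻ : ∀ {m} (p : Subset m) y {x} → x ∈ p ∪ ⁅ y ⁆ → x ∈ p ⊎ x ≡ y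
x∈p∪⁅y⁆⁻ p y x∈ = map₂ (x∈⁅y⁆⇒x≡y y) (x∈p∪q⁻ p ⁅ y ⁆ x∈)

y∈p∪⁅y⁆ : ∀ {m} (p : Subset m) y → y ∈ p ∪ ⁅ y ⁆
y∈p∪⁅y⁆ p y = x∈p∪q⁺ (inj₂ (x∈⁅x⁆ y))

p∩q∪q∩∁p≡q : ∀ {m} (p q : Subset m) → (p ∩ q) ∪ (q ∩ ∁ p) ≡ q
p∩q∪q∩∁p≡q p q = begin
  (p ∩ q) ∪ (q ∩ ∁ p)   ≡⟨ cong (_∪ (q ∩ ∁ p)) (∩-comm p q) ⟩
  (q ∩ p) ∪ (q ∩ ∁ p)   ≡⟨ ∩-distribˡ-∪ q p (∁ p) ⟨
  q ∩ (p ∪ ∁ p)         ≡⟨ cong (q ∩_) (p∪∁p≡⊤ p) ⟩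
  q ∩ ⊤                 ≡⟨ ∩-identityʳ q ⟩
  q                     ∎
  where open ≡.≡-Reasoning

module SetFunction (R : OrderedCommutativeRing) {m : ℕ}
  (f : Subset m → OrderedCommutativeRing.Carrier R) where

  open OrderedCommutativeRing R
  open OrderedCommutativeRingProperties R

  Δ : Subset m → Fin m → Carrier
  Δ S e = f (S ∪ ⁅ e ⁆) - f S

  monotone-by-Δ : (∀ S e → 0# ≤ Δ S e) → ∀ F F′ → F ⊆ F′ → f F ≤ f F′
  monotone-by-Δ Δ≥0 F F′ F⊆F′ =
    subst (λ S → f F ≤ f S) (p⊆q⇒p∪q≡q F⊆F′)
      (Subset-ind (λ S → f F ≤ f (F ∪ S)) F′ base step)
    where
    base : f F ≤ f (F ∪ ∅)
    base = ≤-reflexive (reflexive (cong f (≡.sym (∪-identityʳ F))))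
    step : ∀ S e → e ∈ F′ → f F ≤ f (F ∪ S) → f F ≤ f (F ∪ (S ∪ ⁅ e ⁆))
    step S e _ ih =
      subst (λ S′ → f F ≤ f S′) (∪-assoc F S ⁅ e ⁆) (x≤y∧0≤z-y⇒x≤z ih (Δ≥0 (F ∪ S) e))

  Submodular-at : Subset m → Subset m → Set
  Submodular-at F T = (f (F ∪ T) + f (F ∩ T)) ≤ (f F + f T)

  -- Grow F′ from F ∩ F′ by the elements of F′ ∖ F: adding e ∉ F leaves F ∩ T unchanged and
  -- raises both sides by a marginal, the one of F ∪ T being the smaller.
  submodular-by-Δ : (∀ A B e → A ⊆ B → Δ B e ≤ Δ A e) → ∀ F F′ → Submodular-at F F′
  submodular-by-Δ Δ-antitone F F′ =
    subst (Submodular-at F) (p∩q∪q∩∁p≡q F F′)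
      (Subset-ind (λ S → Submodular-at F (F ∩ F′ ∪ S)) (F′ ∩ ∁ F) base step)
    where
    base : Submodular-at F (F ∩ F′ ∪ ∅)
    base rewrite ∪-identityʳ (F ∩ F′) | ∪-abs-∩ F F′ | ≡.sym (∩-assoc F F F′) | ∩-idem F =
      ≤-refl
    step : ∀ S e → e ∈ F′ ∩ ∁ F →
      Submodular-at F (F ∩ F′ ∪ S) → Submodular-at F (F ∩ F′ ∪ (S ∪ ⁅ e ⁆))
    step S e e∈F′∖F ih rewrite ≡.sym (∪-assoc (F ∩ F′) S ⁅ e ⁆) =
      add-outside (F ∩ F′ ∪ S) ih
      where
      e∉F : e ∉ F
      e∉F = x∈∁p⇒x∉p (proj₂ (x∈p∩q⁻ F′ (∁ F) e∈F′∖F))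
      add-outside : ∀ T → Submodular-at F T → Submodular-at F (T ∪ ⁅ e ⁆)
      add-outside T ih′ rewrite ≡.sym (∪-assoc F T ⁅ e ⁆) | ∩-distribˡ-∪ F T ⁅ e ⁆
                              | x∉p⇒p∩⁅x⁆≡∅ e∉F | ∪-identityʳ (F ∩ T) =
        a+b≤c+d∧a′-a≤d′-d⇒a′+b≤c+d′ ih′ (Δ-antitone T (F ∪ T) e (q⊆p∪q F T))

module Connectivity {Γ : AbelianGroup 0ℓ 0ℓ} (G : GainGraph Γ) where

  open GainGraph G
  open GainGraphFunctions G
  open FinBool
  open ≡ using (refl; sym; trans)
  open Nat using (_+_; _∸_; _≤_; _<_; s≤s; z≤n)

  ∈⇒inF : ∀ {F e} → e ∈ F → inF F e ≡ true
  ∈⇒inF = []=⇒lookup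

  inF⇒∈ : ∀ {F e} → inF F e ≡ true → e ∈ F
  inF⇒∈ = lookup⇒[]= _ _

  _~[_]_ : Fin n → Subset m → Fin n → Set
  u ~[ F ] v = connected F u v ≡ true

  Joins : Fin m → Fin n → Fin n → Set
  Joins e u v = (tail e ≡ u × head e ≡ v) ⊎ (head e ≡ u × tail e ≡ v)

  Joins-sym : ∀ {e u v} → Joins e u v → Joins e v u
  Joins-sym (inj₁ (t≡u , h≡v)) = inj₂ (h≡v , t≡u)
  Joins-sym (inj₂ (h≡u , t≡v)) = inj₁ (t≡v , h≡u)

  adj⁻ : ∀ F {u v} → adj F u v ≡ true → ∃ λ e → e ∈ F × Joins e u v
  adj⁻ F p with anyFin⁻ _ p
  ... | e , q with ∧-true⁻ q
  ... | e∈F , ends = e , inF⇒∈ e∈F , Data.Sum.map both both (∨-true⁻ ends)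
    where
    both : ∀ {x y} {a b : Fin n} → ⌊ x ≟ a ⌋ ∧ ⌊ y ≟ b ⌋ ≡ true → x ≡ a × y ≡ b
    both r = ⌊⌋-true⁻ (_ ≟ _) (proj₁ (∧-true⁻ r)) , ⌊⌋-true⁻ (_ ≟ _) (proj₂ (∧-true⁻ r))

  adj⁺ : ∀ F {u v} e → e ∈ F → Joins e u v → adj F u v ≡ true
  adj⁺ F e e∈F joins = anyFin⁺ _ e (∧-true⁺ (∈⇒inF e∈F) (ends joins))
    where
    both : ∀ {x y} {a b : Fin n} → x ≡ a → y ≡ b → ⌊ x ≟ a ⌋ ∧ ⌊ y ≟ b ⌋ ≡ true
    both x≡a y≡b = ∧-true⁺ (⌊⌋-true⁺ (_ ≟ _) x≡a) (⌊⌋-true⁺ (_ ≟ _) y≡b)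
    ends : ∀ {u v} → Joins e u v →
      (⌊ tail e ≟ u ⌋ ∧ ⌊ head e ≟ v ⌋ ∨ ⌊ head e ≟ u ⌋ ∧ ⌊ tail e ≟ v ⌋) ≡ true
    ends (inj₁ (t≡u , h≡v)) = ∨-true⁺ˡ _ (both t≡u h≡v)
    ends (inj₂ (h≡u , t≡v)) = ∨-true⁺ʳ _ (both h≡u t≡v)

  adj-sym : ∀ F {u v} → adj F u v ≡ true → adj F v u ≡ true
  adj-sym F p with adj⁻ F p
  ... | e , e∈F , joins = adj⁺ F e e∈F (Joins-sym joins)

  adj-mono : ∀ {F F′} → F ⊆ F′ → ∀ {u v} → adj F u v ≡ true → adj F′ u v ≡ true
  adj-mono {F} {F′} F⊆F′ p with adj⁻ F p
  ... | e , e∈F , joins = adj⁺ F′ e (F⊆F′ e∈F) joins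

  module _ (F : Subset m) where

    reach-suc⁻ : ∀ k {u v} → reach F (suc k) u v ≡ true →
      reach F k u v ≡ true ⊎ ∃ λ w → reach F k u w ≡ true × adj F w v ≡ true
    reach-suc⁻ k p with ∨-true⁻ p
    ... | inj₁ q = inj₁ q
    ... | inj₂ q with anyFin⁻ _ q
    ... | w , r = inj₂ (w , ∧-true⁻ r)

    reach-weaken : ∀ k {u v} → reach F k u v ≡ true → reach F (suc k) u v ≡ true
    reach-weaken k = ∨-true⁺ˡ _

    reach-step : ∀ k {u w v} → reach F k u w ≡ true → adj F w v ≡ true →
      reach F (suc k) u v ≡ true
    reach-step k {w = w} p q = ∨-true⁺ʳ _ (anyFin⁺ _ w (∧-true⁺ p q))

    reach-refl : ∀ k u → reach F k u u ≡ true
    reach-refl zero    u = ⌊⌋-true⁺ (u ≟ u) refl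
    reach-refl (suc k) u = reach-weaken k (reach-refl k u)

    reach-ind : (P : Fin n → Fin n → Set) → (∀ u → P u u) →
      (∀ {u w v} → P u w → adj F w v ≡ true → P u v) →
      ∀ k {u v} → reach F k u v ≡ true → P u v
    reach-ind P P-refl P-step zero {u} p with ⌊⌋-true⁻ (u ≟ _) p
    ... | refl = P-refl u
    reach-ind P P-refl P-step (suc k) p with reach-suc⁻ k p
    ... | inj₁ q            = reach-ind P P-refl P-step k q
    ... | inj₂ (w , q , wv) = P-step (reach-ind P P-refl P-step k q) wv

    reach-trans : ∀ j k {u w v} → reach F j u w ≡ true → reach F k w v ≡ true →
      reach F (k + j) u v ≡ true
    reach-trans j zero {u} {w} p q with ⌊⌋-true⁻ (w ≟ _) q
    ... | refl = p
    reach-trans j (suc k) p q with reach-suc⁻ k q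
    ... | inj₁ r            = reach-weaken (k + j) (reach-trans j k p r)
    ... | inj₂ (x , r , xv) = reach-step (k + j) (reach-trans j k p r) xv

    reach-sym : ∀ k {u v} → reach F k u v ≡ true → reach F k v u ≡ true
    reach-sym zero {u} p with ⌊⌋-true⁻ (u ≟ _) p
    ... | refl = p
    reach-sym (suc k) {u} {v} p with reach-suc⁻ k p
    ... | inj₁ q            = reach-weaken k (reach-sym k q)
    ... | inj₂ (w , q , wv) = subst (λ j → reach F j v u ≡ true) (ℕₚ.+-comm k 1)
          (reach-trans 1 k (reach-step 0 (reach-refl 0 v) (adj-sym F wv)) (reach-sym k q))

    -- Once one more step reaches nothing new, nothing new is ever reached; before that, each
    -- step reaches a new vertex. So reachability saturates within n steps.
    module Saturation (u : Fin n) where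

      Saturated : ℕ → Set
      Saturated k = ∀ v → reach F (suc k) u v ≡ true → reach F k u v ≡ true

      saturated-suc : ∀ k → Saturated k → Saturated (suc k)
      saturated-suc k sat v p with reach-suc⁻ (suc k) p
      ... | inj₁ q            = q
      ... | inj₂ (w , q , wv) = reach-step k (sat w q) wv

      saturated-+ : ∀ k → Saturated k → ∀ j → Saturated (j + k)
      saturated-+ k sat zero    = sat
      saturated-+ k sat (suc j) = saturated-suc (j + k) (saturated-+ k sat j)

      saturated-reach : ∀ k → Saturated k →
        ∀ j v → reach F (j + k) u v ≡ true → reach F k u v ≡ true
      saturated-reach k sat zero    v p = p
      saturated-reach k sat (suc j) v p = saturated-reach k sat j v (saturated-+ k sat j v p)

      saturated? : ∀ k →
        Saturated k ⊎ ∃ λ v → reach F (suc k) u v ≡ true × reach F k u v ≡ false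
      saturated? k
        with any? (λ v → (reach F (suc k) u v Boolₚ.≟ true) ×-dec (reach F k u v Boolₚ.≟ false))
      ... | yes found = inj₂ found
      ... | no ¬found = inj₁ (λ v p → Boolₚ.¬-not (λ q → ¬found (v , p , q)))

      saturated-or-grows : ∀ k → (∃ λ j → j ≤ k × Saturated j) ⊎ k < countFin (reach F k u)
      saturated-or-grows zero = inj₂ (countFin-pos _ u (reach-refl 0 u))
      saturated-or-grows (suc k) with saturated-or-grows k
      ... | inj₁ (j , j≤k , sat) = inj₁ (j , ℕₚ.m≤n⇒m≤1+n j≤k , sat)
      ... | inj₂ k<count with saturated? k
      ... | inj₁ sat = inj₁ (k , ℕₚ.n≤1+n k , sat)
      ... | inj₂ (v , new , old) =
        inj₂ (ℕₚ.≤-trans (s≤s k<count) (countFin-mono-< _ _ (λ w → reach-weaken k) v new old))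

      saturated-≤n : ∃ λ j → j ≤ n × Saturated j
      saturated-≤n with saturated-or-grows n
      ... | inj₁ found = found
      ... | inj₂ n<count = ⊥-elim (ℕₚ.<⇒≱ n<count (countFin≤k _))

    reach-mono : ∀ {k k′ u v} → k ≤ k′ → reach F k u v ≡ true → reach F k′ u v ≡ true
    reach-mono {k} {k′} {u} {v} k≤k′ p =
      subst (λ i → reach F i u v ≡ true) (ℕₚ.m+[n∸m]≡n k≤k′)
        (reach-trans (k′ ∸ k) k (reach-refl (k′ ∸ k) u) p)

    reach⇒connected : ∀ k {u v} → reach F k u v ≡ true → u ~[ F ] v
    reach⇒connected k {u} {v} p with Saturation.saturated-≤n u
    ... | j , j≤n , sat =
      reach-mono j≤n (Saturation.saturated-reach u j sat k v (reach-mono (ℕₚ.m≤m+n k j) p))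

    connected-refl : ∀ u → u ~[ F ] u
    connected-refl = reach-refl n

    connected-sym : ∀ {u v} → u ~[ F ] v → v ~[ F ] u
    connected-sym = reach-sym n

    connected-trans : ∀ {u w v} → u ~[ F ] w → w ~[ F ] v → u ~[ F ] v
    connected-trans p q = reach⇒connected (n + n) (reach-trans n n p q)

    adj⇒connected : ∀ {u v} → adj F u v ≡ true → u ~[ F ] v
    adj⇒connected p = reach⇒connected 1 (reach-step 0 (reach-refl 0 _) p)

    connected-ind : (P : Fin n → Fin n → Set) → (∀ u → P u u) →
      (∀ {u w v} → P u w → adj F w v ≡ true → P u v) → ∀ {u v} → u ~[ F ] v → P u v
    connected-ind P P-refl P-step = reach-ind P P-refl P-step n

    ∉V⇒connected-only-to-itself : ∀ {v} → lookup (VF F) v ≡ false →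
      ∀ {w} → w ~[ F ] v → w ≡ v
    ∉V⇒connected-only-to-itself {v} v∉V p =
      connected-ind (λ a b → b ≡ v → a ≡ b) (λ _ _ → refl) step p refl
      where
      endpoint∈V : ∀ {e x} → e ∈ F → Joins e x v → lookup (VF F) v ≡ true
      endpoint∈V {e} e∈F joins =
        trans (lookup∘tabulate _ v) (anyFin⁺ _ e (∧-true⁺ (∈⇒inF e∈F) (ends joins)))
        where
        ends : ∀ {x} → Joins e x v → (⌊ tail e ≟ v ⌋ ∨ ⌊ head e ≟ v ⌋) ≡ true
        ends (inj₁ (_ , h≡v)) = ∨-true⁺ʳ _ (⌊⌋-true⁺ (_ ≟ _) h≡v)
        ends (inj₂ (_ , t≡v)) = ∨-true⁺ˡ _ (⌊⌋-true⁺ (_ ≟ _) t≡v)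
      step : ∀ {a x b} → (x ≡ v → a ≡ x) → adj F x b ≡ true → b ≡ v → a ≡ b
      step _ xb refl with adj⁻ F xb
      ... | e , e∈F , joins = ⊥-elim (true≢false (endpoint∈V e∈F joins) v∉V)

  connected-mono : ∀ {F F′} → F ⊆ F′ → ∀ {u v} → u ~[ F ] v → u ~[ F′ ] v
  connected-mono {F} {F′} F⊆F′ =
    connected-ind F (λ u v → u ~[ F′ ] v) (connected-refl F′)
      (λ uw wv → connected-trans F′ uw (adj⇒connected F′ (adj-mono F⊆F′ wv)))

module Components {Γ : AbelianGroup 0ℓ 0ℓ} (G : GainGraph Γ) where

  open GainGraph G
  open GainGraphFunctions G
  open Connectivity G
  open FinBool
  open ≡ using (refl; sym; trans)
  open import Data.Fin using (_<_)
  open Nat using (_+_)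

  isLeast : Subset m → Fin n → Bool
  isLeast F v = allFin λ w → not ⌊ w <? v ⌋ ∨ not (connected F w v)

  -- Components of the spanning graph (Fin n, F), counted through their least vertices; unlike
  -- c F this includes the isolated vertices outside V(F).
  κ : Subset m → ℕ
  κ F = countFin (isLeast F)

  isLeast⁻ : ∀ F {v} → isLeast F v ≡ true → ∀ {w} → w < v → connected F w v ≡ false
  isLeast⁻ F p {w} w<v with ∨-true⁻ (allFin⁻ _ p w)
  ... | inj₁ q = ⊥-elim (true≢false (⌊⌋-true⁺ (w <? _) w<v) (Boolₚ.not-injective q))
  ... | inj₂ q = Boolₚ.not-injective q

  isLeast⁺ : ∀ F {v} → (∀ {w} → w < v → connected F w v ≡ false) → isLeast F v ≡ true
  isLeast⁺ F {v} below = allFin⁺ _ pointwise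
    where
    pointwise : ∀ w → (not ⌊ w <? v ⌋ ∨ not (connected F w v)) ≡ true
    pointwise w with w <? v
    ... | yes w<v = cong not (below w<v)
    ... | no  _   = refl

  isLeast-unique : ∀ F {v v′} → isLeast F v ≡ true → isLeast F v′ ≡ true →
    v ~[ F ] v′ → v ≡ v′
  isLeast-unique F {v} {v′} least least′ v~v′ with Finₚ.<-cmp v v′
  ... | tri< v<v′ _ _ = ⊥-elim (true≢false v~v′ (isLeast⁻ F least′ v<v′))
  ... | tri≈ _ v≡v′ _ = v≡v′
  ... | tri> _ _ v′<v = ⊥-elim (true≢false (connected-sym F v~v′) (isLeast⁻ F least v′<v))

  isLeast-exists : ∀ F x → ∃ λ a → a ~[ F ] x × isLeast F a ≡ true
  isLeast-exists F x with least-witness (λ w → connected F w x) (connected-refl F x)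
  ... | a , a~x , below =
    a , a~x , isLeast⁺ F (λ w<a → Boolₚ.¬-not (λ w~a →
                 true≢false (connected-trans F w~a a~x) (below w<a)))

  isLeast-coarsen : ∀ {F F′ v} → (∀ {w} → w ~[ F′ ] v → w ~[ F ] v) →
    isLeast F v ≡ true → isLeast F′ v ≡ true
  isLeast-coarsen {F} {F′} F′⇒F least =
    isLeast⁺ F′ (λ w<v → Boolₚ.¬-not (λ w~v → true≢false (F′⇒F w~v) (isLeast⁻ F least w<v)))

  ∣V∣+κ≡c+n : ∀ F → ∣ VF F ∣ + κ F ≡ c F + n
  ∣V∣+κ≡c+n F = begin
    ∣ VF F ∣ + κ F                    ≡⟨ cong₂ _+_ ∣V∣≡ (countFin-split inV (isLeast F)) ⟩
    #V + (c F + countFin (λ v → not (inV v) ∧ isLeast F v))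
                                      ≡⟨ cong (λ k → #V + (c F + k)) (countFin-cong _ _ outside-least) ⟩
    #V + (c F + #outside)             ≡⟨ ℕₚ.+-comm #V _ ⟩
    (c F + #outside) + #V             ≡⟨ ℕₚ.+-assoc (c F) #outside #V ⟩
    c F + (#outside + #V)             ≡⟨ cong (c F +_) (countFin-not inV) ⟩
    c F + n                           ∎
    where
    open ≡.≡-Reasoning
    inV : Fin n → Bool
    inV = lookup (VF F)
    #V = countFin inV
    #outside = countFin (λ v → not (inV v))
    ∣V∣≡ : ∣ VF F ∣ ≡ #V
    endpoint : Fin n → Bool
    endpoint v = anyFin λ e → inF F e ∧ (⌊ tail e ≟ v ⌋ ∨ ⌊ head e ≟ v ⌋)
    ∣V∣≡ = trans (∣tabulate∣ endpoint) (countFin-cong _ _ (λ v → sym (lookup∘tabulate endpoint v)))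
    outside-least : ∀ v → (not (inV v) ∧ isLeast F v) ≡ not (inV v)
    outside-least v with inV v in v∉V
    ... | true  = refl
    ... | false = isLeast⁺ F (λ w<v → Boolₚ.¬-not (λ w~v →
                    Finₚ.<⇒≢ w<v (∉V⇒connected-only-to-itself F v∉V w~v)))

  record Merges (F F′ : Subset m) (p q : Fin n) : Set where
    field
      refines : ∀ {x y} → x ~[ F ] y → x ~[ F′ ] y
      joins   : p ~[ F′ ] q
      only    : ∀ {x y} → x ~[ F′ ] y →
                x ~[ F ] y ⊎ (x ~[ F ] p × q ~[ F ] y) ⊎ (x ~[ F ] q × p ~[ F ] y)

  Merges-sym : ∀ {F F′ p q} → Merges F F′ p q → Merges F F′ q p
  Merges-sym {F′ = F′} M = record
    { refines = refines
    ; joins   = connected-sym F′ joins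
    ; only    = λ x~y → map₂ swap (only x~y)
    }
    where open Merges M

  merge-within-component : ∀ {F F′ p q} → Merges F F′ p q → p ~[ F ] q → κ F′ ≡ κ F
  merge-within-component {F} {F′} {p} {q} M p~q =
    countFin-cong _ _ (λ v → true⇔true⇒≡ (isLeast-coarsen {v = v} refines) (isLeast-coarsen F′⇒F))
    where
    open Merges M
    F′⇒F : ∀ {x y} → x ~[ F′ ] y → x ~[ F ] y
    F′⇒F x~y with only x~y
    ... | inj₁ x~y′             = x~y′
    ... | inj₂ (inj₁ (x~p , q~y)) = connected-trans F x~p (connected-trans F p~q q~y)
    ... | inj₂ (inj₂ (x~q , p~y)) = connected-trans F x~q (connected-trans F (connected-sym F p~q) p~y)

  -- The larger of the two least vertices stops being least; nothing else changes.
  merge-drops-least : ∀ {F F′ p q} → Merges F F′ p q →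
    ∀ {a b} → a ~[ F ] p → isLeast F a ≡ true → b ~[ F ] q → isLeast F b ≡ true → a < b →
    κ F ≡ suc (κ F′)
  merge-drops-least {F} {F′} {p} {q} M {a} {b} a~p a-least b~q b-least a<b =
    countFin-drop (isLeast F) (isLeast F′) b same b-least b-not-least′
    where
    open Merges M
    a~b′ : a ~[ F′ ] b
    a~b′ = connected-trans F′ (refines a~p) (connected-trans F′ joins (refines (connected-sym F b~q)))
    b-not-least′ : isLeast F′ b ≡ false
    b-not-least′ = Boolₚ.¬-not (λ b-least′ → true≢false a~b′ (isLeast⁻ F′ b-least′ a<b))
    same : ∀ v → v ≢ b → isLeast F v ≡ isLeast F′ v
    same v v≢b = true⇔true⇒≡ least⇒least′ (isLeast-coarsen {v = v} refines)
      where
      least⇒least′ : isLeast F v ≡ true → isLeast F′ v ≡ true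
      least⇒least′ v-least =
        isLeast⁺ F′ (λ w<v → Boolₚ.¬-not (λ w~v → impossible w<v (only w~v)))
        where
        impossible : ∀ {w} → w < v →
          w ~[ F ] v ⊎ (w ~[ F ] p × q ~[ F ] v) ⊎ (w ~[ F ] q × p ~[ F ] v) → ⊥
        impossible w<v (inj₁ w~v) = true≢false w~v (isLeast⁻ F v-least w<v)
        impossible w<v (inj₂ (inj₁ (_ , q~v))) =
          v≢b (sym (isLeast-unique F b-least v-least (connected-trans F b~q q~v)))
        impossible w<v (inj₂ (inj₂ (w~q , p~v)))
          with isLeast-unique F a-least v-least (connected-trans F a~p p~v)
        ... | refl = true≢false (connected-trans F w~q (connected-sym F b~q))
                                (isLeast⁻ F b-least (Finₚ.<-trans w<v a<b))

  merge-across-components : ∀ {F F′ p q} → Merges F F′ p q → connected F p q ≡ false →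
    κ F ≡ suc (κ F′)
  merge-across-components {F} {F′} {p} {q} M p≁q
    with isLeast-exists F p | isLeast-exists F q
  ... | a , a~p , a-least | b , b~q , b-least with Finₚ.<-cmp a b
  ... | tri< a<b _ _ = merge-drops-least M a~p a-least b~q b-least a<b
  ... | tri≈ _ refl _ = ⊥-elim (true≢false (connected-trans F (connected-sym F a~p) b~q) p≁q)
  ... | tri> _ _ b<a = merge-drops-least (Merges-sym M) b~q b-least a~p a-least b<a

  add-edge-merges : ∀ F e → Merges F (F ∪ ⁅ e ⁆) (tail e) (head e)
  add-edge-merges F e = record
    { refines = connected-mono (p⊆p∪q {p = F} ⁅ e ⁆)
    ; joins   = adj⇒connected F⁺ (adj⁺ F⁺ e (y∈p∪⁅y⁆ F e) (inj₁ (refl , refl)))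
    ; only    = connected-ind F⁺ Reach⁺ (λ u → inj₁ (connected-refl F u)) step
    }
    where
    F⁺ : Subset m
    F⁺ = F ∪ ⁅ e ⁆
    t h : Fin n
    t = tail e
    h = head e
    Reach⁺ : Fin n → Fin n → Set
    Reach⁺ x y = x ~[ F ] y ⊎ (x ~[ F ] t × h ~[ F ] y) ⊎ (x ~[ F ] h × t ~[ F ] y)
    along-F : ∀ {x w y} → Reach⁺ x w → w ~[ F ] y → Reach⁺ x y
    along-F (inj₁ x~w)               w~y = inj₁ (connected-trans F x~w w~y)
    along-F (inj₂ (inj₁ (x~t , h~w))) w~y = inj₂ (inj₁ (x~t , connected-trans F h~w w~y))
    along-F (inj₂ (inj₂ (x~h , t~w))) w~y = inj₂ (inj₂ (x~h , connected-trans F t~w w~y))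
    along-e : ∀ {x w y} → Reach⁺ x w → Joins e w y → Reach⁺ x y
    along-e (inj₁ x~w)           (inj₁ (refl , refl)) = inj₂ (inj₁ (x~w , connected-refl F h))
    along-e (inj₁ x~w)           (inj₂ (refl , refl)) = inj₂ (inj₂ (x~w , connected-refl F t))
    along-e (inj₂ (inj₁ (x~t , _))) (inj₁ (refl , refl)) = inj₂ (inj₁ (x~t , connected-refl F h))
    along-e (inj₂ (inj₁ (x~t , _))) (inj₂ (refl , refl)) = inj₁ x~t
    along-e (inj₂ (inj₂ (x~h , _))) (inj₁ (refl , refl)) = inj₁ x~h
    along-e (inj₂ (inj₂ (x~h , _))) (inj₂ (refl , refl)) = inj₂ (inj₂ (x~h , connected-refl F t))
    along : ∀ {x w y e′} → Reach⁺ x w → e′ ∈ F ⊎ e′ ≡ e → Joins e′ w y → Reach⁺ x y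
    along x⇝w (inj₁ e′∈F) joins = along-F x⇝w (adj⇒connected F (adj⁺ F _ e′∈F joins))
    along x⇝w (inj₂ refl) joins = along-e x⇝w joins
    step : ∀ {x w y} → Reach⁺ x w → adj F⁺ w y ≡ true → Reach⁺ x y
    step x⇝w w-y with adj⁻ F⁺ w-y
    ... | e′ , e′∈F⁺ , joins = along x⇝w (x∈p∪⁅y⁆⁻ F e e′∈F⁺) joins

module Subgroups (Γ : AbelianGroup 0ℓ 0ℓ) where

  open GroupSubsets Γ

  ⟨⟩-least : ∀ {X Y} → X ⊆Γ ⟨ Y ⟩ → ⟨ X ⟩ ⊆Γ ⟨ Y ⟩
  ⟨⟩-least X⊆ x (gen x∈X)   = X⊆ x x∈X
  ⟨⟩-least X⊆ _ unit        = unit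
  ⟨⟩-least X⊆ _ (inv p)     = inv (⟨⟩-least X⊆ _ p)
  ⟨⟩-least X⊆ _ (mul p q)   = mul (⟨⟩-least X⊆ _ p) (⟨⟩-least X⊆ _ q)
  ⟨⟩-least X⊆ _ (resp x≈y p) = resp x≈y (⟨⟩-least X⊆ _ p)

  ⟨⟩-mono : ∀ {X Y} → X ⊆Γ Y → ⟨ X ⟩ ⊆Γ ⟨ Y ⟩
  ⟨⟩-mono X⊆Y = ⟨⟩-least (λ x x∈X → gen (X⊆Y x x∈X))

module GainAlgebra (Γ : AbelianGroup 0ℓ 0ℓ) where

  open AbelianGroup Γ
  open import Algebra.Properties.AbelianGroup Γ using (⁻¹-∙-comm)
  open import Algebra.Properties.Group group using (⁻¹-involutive)
  open import Algebra.Solver.CommutativeMonoid commutativeMonoid using (solve; _⊜_; _⊕_)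
  open import Relation.Binary.Reasoning.Setoid setoid

  x∙[a∙a⁻¹]≈x : ∀ x a → x ∙ (a ∙ a ⁻¹) ≈ x
  x∙[a∙a⁻¹]≈x x a = trans (∙-congˡ (inverseʳ a)) (identityʳ x)

  [a∙b]⁻¹≈a⁻¹∙b⁻¹ : ∀ a b → (a ∙ b) ⁻¹ ≈ a ⁻¹ ∙ b ⁻¹
  [a∙b]⁻¹≈a⁻¹∙b⁻¹ a b = sym (⁻¹-∙-comm a b)

  x≈y∙z⇒x∙a≈y∙a∙z : ∀ {x y z} a → x ≈ y ∙ z → x ∙ a ≈ (y ∙ a) ∙ z
  x≈y∙z⇒x∙a≈y∙a∙z {x} {y} {z} a x≈yz = begin
    x ∙ a       ≈⟨ ∙-congʳ x≈yz ⟩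
    (y ∙ z) ∙ a ≈⟨ solve 3 (λ y z a → ((y ⊕ z) ⊕ a) ⊜ ((y ⊕ a) ⊕ z)) refl y z a ⟩
    (y ∙ a) ∙ z ∎

  inverse-of-step : ∀ {b c d} → c ≈ d ⁻¹ → (ε ∙ c) ∙ b ⁻¹ ≈ (b ∙ d) ⁻¹
  inverse-of-step {b} {c} {d} c≈d⁻¹ = begin
    (ε ∙ c) ∙ b ⁻¹  ≈⟨ ∙-congʳ (identityˡ c) ⟩
    c ∙ b ⁻¹        ≈⟨ comm c (b ⁻¹) ⟩
    b ⁻¹ ∙ c        ≈⟨ ∙-congˡ c≈d⁻¹ ⟩
    b ⁻¹ ∙ d ⁻¹     ≈⟨ [a∙b]⁻¹≈a⁻¹∙b⁻¹ b d ⟨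
    (b ∙ d) ⁻¹      ∎

  x≈y∙z⇒x∙a≈[y∙g]∙[z∙[g∙a⁻¹]⁻¹] : ∀ {x y z} g a → x ≈ y ∙ z →
    x ∙ a ≈ (y ∙ g) ∙ (z ∙ (g ∙ a ⁻¹) ⁻¹)
  x≈y∙z⇒x∙a≈[y∙g]∙[z∙[g∙a⁻¹]⁻¹] {x} {y} {z} g a x≈yz = begin
    x ∙ a                             ≈⟨ ∙-congʳ x≈yz ⟩
    (y ∙ z) ∙ a                       ≈⟨ x∙[a∙a⁻¹]≈x ((y ∙ z) ∙ a) g ⟨
    ((y ∙ z) ∙ a) ∙ (g ∙ g ⁻¹)
      ≈⟨ solve 5 (λ y z a g g⁻¹ → (((y ⊕ z) ⊕ a) ⊕ (g ⊕ g⁻¹)) ⊜ ((y ⊕ g) ⊕ (z ⊕ (g⁻¹ ⊕ a))))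
          refl y z a g (g ⁻¹) ⟩
    (y ∙ g) ∙ (z ∙ (g ⁻¹ ∙ a))        ≈⟨ ∙-congˡ (∙-congˡ (∙-congˡ (⁻¹-involutive a))) ⟨
    (y ∙ g) ∙ (z ∙ (g ⁻¹ ∙ a ⁻¹ ⁻¹))  ≈⟨ ∙-congˡ (∙-congˡ ([a∙b]⁻¹≈a⁻¹∙b⁻¹ g (a ⁻¹))) ⟨
    (y ∙ g) ∙ (z ∙ (g ∙ a ⁻¹) ⁻¹)     ∎

  x≈y∙z⇒x∙a⁻¹≈[y∙g⁻¹]∙[z∙[g∙a⁻¹]] : ∀ {x y z} g a → x ≈ y ∙ z →
    x ∙ a ⁻¹ ≈ (y ∙ g ⁻¹) ∙ (z ∙ (g ∙ a ⁻¹))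
  x≈y∙z⇒x∙a⁻¹≈[y∙g⁻¹]∙[z∙[g∙a⁻¹]] {x} {y} {z} g a x≈yz = begin
    x ∙ a ⁻¹                          ≈⟨ ∙-congʳ x≈yz ⟩
    (y ∙ z) ∙ a ⁻¹                    ≈⟨ x∙[a∙a⁻¹]≈x ((y ∙ z) ∙ a ⁻¹) g ⟨
    ((y ∙ z) ∙ a ⁻¹) ∙ (g ∙ g ⁻¹)
      ≈⟨ solve 5 (λ y z a⁻¹ g g⁻¹ → (((y ⊕ z) ⊕ a⁻¹) ⊕ (g ⊕ g⁻¹))
                                     ⊜ ((y ⊕ g⁻¹) ⊕ (z ⊕ (g ⊕ a⁻¹))))
          refl y z (a ⁻¹) g (g ⁻¹) ⟩
    (y ∙ g ⁻¹) ∙ (z ∙ (g ∙ a ⁻¹))     ∎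

  x≈c∙y∙z⇒x∙a≈c∙[y∙a]∙z : ∀ {x c y z} a → x ≈ (c ∙ y) ∙ z → x ∙ a ≈ (c ∙ (y ∙ a)) ∙ z
  x≈c∙y∙z⇒x∙a≈c∙[y∙a]∙z {x} {c} {y} {z} a x≈cyz = begin
    x ∙ a               ≈⟨ ∙-congʳ x≈cyz ⟩
    ((c ∙ y) ∙ z) ∙ a   ≈⟨ solve 4 (λ c y z a → (((c ⊕ y) ⊕ z) ⊕ a) ⊜ ((c ⊕ (y ⊕ a)) ⊕ z))
                                refl c y z a ⟩
    (c ∙ (y ∙ a)) ∙ z   ∎

  x≈y∙z⇒x∙a≈y∙a∙ε∙z : ∀ {x y z} a → x ≈ y ∙ z → x ∙ a ≈ ((y ∙ a) ∙ ε) ∙ z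
  x≈y∙z⇒x∙a≈y∙a∙ε∙z a x≈yz = trans (x≈y∙z⇒x∙a≈y∙a∙z a x≈yz) (∙-congʳ (sym (identityʳ _)))

  x≈y∙a∙y′∙z⇒x∙b≈y∙[y′∙z] : ∀ {x y a y′ z b} → a ∙ b ≈ ε →
    x ≈ ((y ∙ a) ∙ y′) ∙ z → x ∙ b ≈ y ∙ (y′ ∙ z)
  x≈y∙a∙y′∙z⇒x∙b≈y∙[y′∙z] {x} {y} {a} {y′} {z} {b} ab≈ε x≈ = begin
    x ∙ b                       ≈⟨ ∙-congʳ x≈ ⟩
    (((y ∙ a) ∙ y′) ∙ z) ∙ b
      ≈⟨ solve 5 (λ y a y′ z b → ((((y ⊕ a) ⊕ y′) ⊕ z) ⊕ b) ⊜ ((y ⊕ (y′ ⊕ z)) ⊕ (a ⊕ b)))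
          refl y a y′ z b ⟩
    (y ∙ (y′ ∙ z)) ∙ (a ∙ b)    ≈⟨ ∙-congˡ ab≈ε ⟩
    (y ∙ (y′ ∙ z)) ∙ ε          ≈⟨ identityʳ _ ⟩
    y ∙ (y′ ∙ z)                ∎

module Walks {Γ : AbelianGroup 0ℓ 0ℓ} (G : GainGraph Γ) where

  open AbelianGroup Γ
  open GainGraph G
  open GainGraphFunctions G
  open GroupSubsets Γ
  open Subgroups Γ
  open GainAlgebra Γ
  open Connectivity G
  open FinBool using (true≢false)
  open import Algebra.Properties.Group group using (ε⁻¹≈ε; ⁻¹-involutive)

  Walk≈ : Subset m → Fin n → Fin n → Carrier → Set
  Walk≈ F u v x = ∃ λ y → Walk F u v y × y ≈ x

  walk-mono : ∀ {F F′} → F ⊆ F′ → ∀ {u v g} → Walk F u v g → Walk F′ u v g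
  walk-mono F⊆F′ []                = []
  walk-mono F⊆F′ (fwd e e∈F t≡w W) = fwd e (∈⇒inF (F⊆F′ (inF⇒∈ e∈F))) t≡w (walk-mono F⊆F′ W)
  walk-mono F⊆F′ (bwd e e∈F h≡w W) = bwd e (∈⇒inF (F⊆F′ (inF⇒∈ e∈F))) h≡w (walk-mono F⊆F′ W)

  ⟪⟫-mono : ∀ {F F′} → F ⊆ F′ → ⟪ F ⟫ ⊆Γ ⟪ F′ ⟫
  ⟪⟫-mono F⊆F′ = ⟨⟩-mono (λ { x (u , W) → u , walk-mono F⊆F′ W })

  _++_ : ∀ {F u w v g₁ g₂} → Walk F u w g₁ → Walk F w v g₂ → Walk≈ F u v (g₁ ∙ g₂)
  W₁ ++ [] = _ , W₁ , sym (identityʳ _)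
  W₁ ++ fwd e e∈F t≡w W₂ with W₁ ++ W₂
  ... | _ , W , y≈ = _ , fwd e e∈F t≡w W , trans (∙-congʳ y≈) (assoc _ _ _)
  W₁ ++ bwd e e∈F h≡w W₂ with W₁ ++ W₂
  ... | _ , W , y≈ = _ , bwd e e∈F h≡w W , trans (∙-congʳ y≈) (assoc _ _ _)

  reverse : ∀ {F u v g} → Walk F u v g → Walk≈ F v u (g ⁻¹)
  reverse [] = _ , [] , sym ε⁻¹≈ε
  reverse (fwd e e∈F ≡.refl W) with reverse W
  ... | _ , W′ , y≈ with bwd e e∈F ≡.refl [] ++ W′
  ... | _ , W″ , y″≈ = _ , W″ , trans y″≈ (trans (∙-congˡ y≈) (inverse-of-step refl))
  reverse (bwd e e∈F ≡.refl W) with reverse W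
  ... | _ , W′ , y≈ with fwd e e∈F ≡.refl [] ++ W′
  ... | _ , W″ , y″≈ = _ , W″ , trans y″≈ (trans (∙-congˡ y≈) (inverse-of-step (sym (⁻¹-involutive _))))

  walk⇒connected : ∀ {F u v g} → Walk F u v g → u ~[ F ] v
  walk⇒connected {F} {u} [] = connected-refl F u
  walk⇒connected {F} (fwd e e∈F ≡.refl W) = connected-trans F (walk⇒connected W)
    (adj⇒connected F (adj⁺ F e (inF⇒∈ e∈F) (inj₁ (≡.refl , ≡.refl))))
  walk⇒connected {F} (bwd e e∈F ≡.refl W) = connected-trans F (walk⇒connected W)
    (adj⇒connected F (adj⁺ F e (inF⇒∈ e∈F) (inj₂ (≡.refl , ≡.refl))))

  connected⇒walk : ∀ {F u v} → u ~[ F ] v → ∃ λ g → Walk F u v g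
  connected⇒walk {F} = connected-ind F (λ u v → ∃ λ g → Walk F u v g) (λ u → _ , []) step
    where
    step : ∀ {u w v} → (∃ λ g → Walk F u w g) → adj F w v ≡ true → ∃ λ g → Walk F u v g
    step (_ , W) w-v with adj⁻ F w-v
    ... | e , e∈F , inj₁ (t≡w , ≡.refl) = _ , fwd e (∈⇒inF e∈F) t≡w W
    ... | e , e∈F , inj₂ (h≡w , ≡.refl) = _ , bwd e (∈⇒inF e∈F) h≡w W

  WalkModulo : SubsetΓ → Subset m → Fin n → Fin n → Carrier → Set
  WalkModulo H F u v x = ∃ λ y → Walk F u v y × ∃ λ z → H z × x ≈ y ∙ z

  EdgeStep : Subset m → Fin n → Fin n → Carrier → Set
  EdgeStep F v v′ a = ∀ {u y} → Walk F u v y → Walk F u v′ (y ∙ a)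

  module AddEdge (F : Subset m) (e : Fin m) where

    F⁺ : Subset m
    F⁺ = F ∪ ⁅ e ⁆

    t h : Fin n
    t = tail e
    h = head e

    along-F : ∀ {H u v v′ x a} → EdgeStep F v v′ a → WalkModulo H F u v x → WalkModulo H F u v′ (x ∙ a)
    along-F {a = a} step (y , W , z , z∈H , x≈) = _ , step W , z , z∈H , x≈y∙z⇒x∙a≈y∙a∙z a x≈

    module Cycle {g} (p : Walk F t h g) where

      γ : Carrier
      γ = g ∙ ψ e ⁻¹

      H : SubsetΓ
      H = ⟨ ClosedGain F ∪Γ singleton γ ⟩

      γ∈H : H γ
      γ∈H = gen (inj₂ refl)

      -- Each traversal of e is replaced by p or its reverse, at the cost of a factor γ⁻¹ or γ.
      decompose : ∀ {u v x} → Walk F⁺ u v x → WalkModulo H F u v x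
      decompose [] = _ , [] , ε , unit , sym (identityʳ _)
      decompose (fwd e′ e′∈F⁺ ≡.refl W) with x∈p∪⁅y⁆⁻ F e (inF⇒∈ e′∈F⁺) | decompose W
      ... | inj₁ e′∈F   | W≈ = along-F (fwd e′ (∈⇒inF e′∈F) ≡.refl) W≈
      ... | inj₂ ≡.refl | y , W′ , z , z∈H , x≈ with W′ ++ p
      ... | y′ , W″ , y′≈ =
        y′ , W″ , z ∙ γ ⁻¹ , mul z∈H (inv γ∈H) ,
        trans (x≈y∙z⇒x∙a≈[y∙g]∙[z∙[g∙a⁻¹]⁻¹] g (ψ e) x≈) (∙-congʳ (sym y′≈))
      decompose (bwd e′ e′∈F⁺ ≡.refl W) with x∈p∪⁅y⁆⁻ F e (inF⇒∈ e′∈F⁺) | decompose W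
      ... | inj₁ e′∈F   | W≈ = along-F (bwd e′ (∈⇒inF e′∈F) ≡.refl) W≈
      ... | inj₂ ≡.refl | y , W′ , z , z∈H , x≈ with reverse p
      ... | g′ , p⁻¹ , g′≈ with W′ ++ p⁻¹
      ... | y′ , W″ , y′≈ =
        y′ , W″ , z ∙ γ , mul z∈H γ∈H ,
        trans (x≈y∙z⇒x∙a⁻¹≈[y∙g⁻¹]∙[z∙[g∙a⁻¹]] g (ψ e) x≈) (∙-congʳ (sym (trans y′≈ (∙-congˡ g′≈))))

      closedGain⁺⊆ : ClosedGain F⁺ ⊆Γ H
      closedGain⁺⊆ x (u , W) with decompose W
      ... | y , W′ , z , z∈H , x≈ = resp (sym x≈) (mul (gen (inj₁ (u , W′))) z∈H)

      γ∈closedGain⁺ : ClosedGain F⁺ γ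
      γ∈closedGain⁺ = t , bwd e (∈⇒inF (y∈p∪⁅y⁆ F e)) ≡.refl (walk-mono (p⊆p∪q ⁅ e ⁆) p)

    module Bridge (t≁h : connected F t h ≡ false) where

      Crossing : Fin n → Fin n → Carrier → Fin n → Fin n → Carrier → Set
      Crossing a b δ u v x = ∃ λ y₁ → ∃ λ y₂ → Walk F u a y₁ × Walk F b v y₂ ×
                               ∃ λ z → ⟪ F ⟫ z × x ≈ ((y₁ ∙ δ) ∙ y₂) ∙ z

      -- A walk in F ∪ {e} ends on the side of the bridge it started on, or has crossed it once.
      Decomposition : Fin n → Fin n → Carrier → Set
      Decomposition u v x =
        WalkModulo ⟪ F ⟫ F u v x ⊎ Crossing t h (ψ e) u v x ⊎ Crossing h t (ψ e ⁻¹) u v x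

      t≁h′ : ¬ t ~[ F ] h
      t≁h′ t~h = true≢false t~h t≁h

      along-F′ : ∀ {u v v′ x a} → EdgeStep F v v′ a → Decomposition u v x → Decomposition u v′ (x ∙ a)
      along-F′ step (inj₁ W≈) = inj₁ (along-F step W≈)
      along-F′ {a = a} step (inj₂ (inj₁ (y₁ , y₂ , W₁ , W₂ , z , z∈H , x≈))) =
        inj₂ (inj₁ (y₁ , _ , W₁ , step W₂ , z , z∈H , x≈c∙y∙z⇒x∙a≈c∙[y∙a]∙z a x≈))
      along-F′ {a = a} step (inj₂ (inj₂ (y₁ , y₂ , W₁ , W₂ , z , z∈H , x≈))) =
        inj₂ (inj₂ (y₁ , _ , W₁ , step W₂ , z , z∈H , x≈c∙y∙z⇒x∙a≈c∙[y∙a]∙z a x≈))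

      along-e : ∀ {u x} → Decomposition u t x → Decomposition u h (x ∙ ψ e)
      along-e (inj₁ (y , W , z , z∈H , x≈)) =
        inj₂ (inj₁ (y , ε , W , [] , z , z∈H , x≈y∙z⇒x∙a≈y∙a∙ε∙z (ψ e) x≈))
      along-e (inj₂ (inj₁ (_ , _ , _ , W₂ , _))) = ⊥-elim (t≁h′ (connected-sym F (walk⇒connected W₂)))
      along-e (inj₂ (inj₂ (y₁ , y₂ , W₁ , W₂ , z , z∈H , x≈))) =
        inj₁ (y₁ , W₁ , y₂ ∙ z , mul (gen (t , W₂)) z∈H , x≈y∙a∙y′∙z⇒x∙b≈y∙[y′∙z] (inverseˡ (ψ e)) x≈)

      against-e : ∀ {u x} → Decomposition u h x → Decomposition u t (x ∙ ψ e ⁻¹)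
      against-e (inj₁ (y , W , z , z∈H , x≈)) =
        inj₂ (inj₂ (y , ε , W , [] , z , z∈H , x≈y∙z⇒x∙a≈y∙a∙ε∙z (ψ e ⁻¹) x≈))
      against-e (inj₂ (inj₁ (y₁ , y₂ , W₁ , W₂ , z , z∈H , x≈))) =
        inj₁ (y₁ , W₁ , y₂ ∙ z , mul (gen (h , W₂)) z∈H , x≈y∙a∙y′∙z⇒x∙b≈y∙[y′∙z] (inverseʳ (ψ e)) x≈)
      against-e (inj₂ (inj₂ (_ , _ , _ , W₂ , _))) = ⊥-elim (t≁h′ (walk⇒connected W₂))

      decompose : ∀ {u v x} → Walk F⁺ u v x → Decomposition u v x
      decompose [] = inj₁ (_ , [] , ε , unit , sym (identityʳ _))
      decompose (fwd e′ e′∈F⁺ ≡.refl W) with x∈p∪⁅y⁆⁻ F e (inF⇒∈ e′∈F⁺)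
      ... | inj₁ e′∈F   = along-F′ (fwd e′ (∈⇒inF e′∈F) ≡.refl) (decompose W)
      ... | inj₂ ≡.refl = along-e (decompose W)
      decompose (bwd e′ e′∈F⁺ ≡.refl W) with x∈p∪⁅y⁆⁻ F e (inF⇒∈ e′∈F⁺)
      ... | inj₁ e′∈F   = along-F′ (bwd e′ (∈⇒inF e′∈F) ≡.refl) (decompose W)
      ... | inj₂ ≡.refl = against-e (decompose W)

      closedGain⁺⊆ : ClosedGain F⁺ ⊆Γ ⟪ F ⟫
      closedGain⁺⊆ x (u , W) with decompose W
      ... | inj₁ (y , W′ , z , z∈H , x≈) = resp (sym x≈) (mul (gen (u , W′)) z∈H)
      ... | inj₂ (inj₁ (_ , _ , W₁ , W₂ , _)) =
        ⊥-elim (t≁h′ (connected-sym F (connected-trans F (walk⇒connected W₂) (walk⇒connected W₁))))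
      ... | inj₂ (inj₂ (_ , _ , W₁ , W₂ , _)) =
        ⊥-elim (t≁h′ (connected-trans F (walk⇒connected W₂) (walk⇒connected W₁)))

module Marginals {Γ : AbelianGroup 0ℓ 0ℓ} (R : OrderedCommutativeRing) (G : GainGraph Γ)
  (μ : GroupSubsets.SubsetΓ Γ → OrderedCommutativeRing.Carrier R)
  (μ-polymatroidal : Polymatroidal.IsSymmetricPolymatroidal Γ R μ) where

  open OrderedCommutativeRing R
  open OrderedCommutativeRingProperties R
  open Polymatroidal.IsSymmetricPolymatroidal μ-polymatroidal
  open AbelianGroup Γ using (ε) renaming (refl to ≈Γ-refl; sym to ≈Γ-sym)
  open GroupSubsets Γ
  open Subgroups Γ
  open GainGraph G
  open GainGraphFunctions G
  open Connectivity G
  open Components G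
  open Walks G
  open import Relation.Binary.Reasoning.PartialOrder ≤-poset

  M : Subset m → Carrier
  M F = μ ⟪ F ⟫

  open SetFunction R M using () renaming (Δ to ΔM)
  open SetFunction R (ℓ R μ) using () renaming (Δ to Δℓ)

  K : Subset m → Carrier
  K F = fromℕ (κ F)

  ℓ≈n-K+M : ∀ F → ℓ R μ F ≈ (fromℕ n - K F) + M F
  ℓ≈n-K+M F = +-congʳ (fromℕ-cross ∣ VF F ∣ (c F) n (κ F) (∣V∣+κ≡c+n F))

  Δℓ≈ΔK+ΔM : ∀ F e → Δℓ F e ≈ (K F - K (F ∪ ⁅ e ⁆)) + ΔM F e
  Δℓ≈ΔK+ΔM F e = trans (+-cong (ℓ≈n-K+M (F ∪ ⁅ e ⁆)) (-‿cong (ℓ≈n-K+M F)))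
                       ([a-b+c]-[a-d+e]≈[d-b]+[c-e] _ _ _ _ _)

  ΔM≥0 : ∀ F e → 0# ≤ ΔM F e
  ΔM≥0 F e = x≤y⇒0≤y-x (monotone (⟪⟫-mono (p⊆p∪q ⁅ e ⁆)))

  M-bridge : ∀ F e → connected F (tail e) (head e) ≡ false → M (F ∪ ⁅ e ⁆) ≈ M F
  M-bridge F e t≁h = antisym (monotone (⟨⟩-least (AddEdge.Bridge.closedGain⁺⊆ F e t≁h)))
                             (monotone (⟪⟫-mono (p⊆p∪q ⁅ e ⁆)))

  Δℓ-cycle : ∀ F e → tail e ~[ F ] head e → Δℓ F e ≈ ΔM F e
  Δℓ-cycle F e t~h = begin-equality
    Δℓ F e                          ≈⟨ Δℓ≈ΔK+ΔM F e ⟩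
    (K F - K (F ∪ ⁅ e ⁆)) + ΔM F e  ≈⟨ +-congʳ (+-congˡ (-‿cong (reflexive (cong fromℕ κ-same)))) ⟩
    (K F - K F) + ΔM F e            ≈⟨ +-congʳ (-‿inverseʳ _) ⟩
    0# + ΔM F e                     ≈⟨ +-identityˡ _ ⟩
    ΔM F e                          ∎
    where
    κ-same : κ (F ∪ ⁅ e ⁆) ≡ κ F
    κ-same = merge-within-component (add-edge-merges F e) t~h

  Δℓ-bridge : ∀ F e → connected F (tail e) (head e) ≡ false → Δℓ F e ≈ 1#
  Δℓ-bridge F e t≁h = begin-equality
    Δℓ F e                          ≈⟨ Δℓ≈ΔK+ΔM F e ⟩
    (K F - K⁺) + ΔM F e             ≈⟨ +-congʳ (+-congʳ (reflexive (cong fromℕ κ-drop))) ⟩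
    ((1# + K⁺) - K⁺) + ΔM F e       ≈⟨ +-congʳ (+-assoc 1# K⁺ (- K⁺)) ⟩
    (1# + (K⁺ - K⁺)) + ΔM F e       ≈⟨ +-cong (x+[y-y]≈x 1# K⁺) (x≈y⇒x-y≈0 (M-bridge F e t≁h)) ⟩
    1# + 0#                         ≈⟨ +-identityʳ 1# ⟩
    1#                              ∎
    where
    K⁺ : Carrier
    K⁺ = K (F ∪ ⁅ e ⁆)
    κ-drop : κ F ≡ suc (κ (F ∪ ⁅ e ⁆))
    κ-drop = merge-across-components (add-edge-merges F e) t≁h

  module _ {F : Subset m} {e : Fin m} {g} (p : Walk F (tail e) (head e) g) where

    open AddEdge F e using (module Cycle)
    open Cycle p using (γ; closedGain⁺⊆)

    M-cycle-≤ : (∀ x → μ (singleton x) ≤ 1#) → M (F ∪ ⁅ e ⁆) ≤ (M F + 1#)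
    M-cycle-≤ μ≤1 = begin
      μ ⟪ F ∪ ⁅ e ⁆ ⟫             ≤⟨ monotone ⟪F⁺⟫⊆ ⟩
      μ ⟨ Y ⟩                     ≈⟨ generated Y (γ , inj₂ ≈Γ-refl) ⟨
      μ Y                         ≤⟨ x≤x+y (μ Y) (nonneg _) ⟩
      μ Y + μ (X ∩Γ singleton γ)  ≤⟨ submodular X (singleton γ) ⟩
      μ X + μ (singleton γ)       ≤⟨ +-monoˡ-≤ (μ X) (μ≤1 γ) ⟩
      μ X + 1#                    ∎
      where
      X Y : SubsetΓ
      X = ⟪ F ⟫
      Y = X ∪Γ singleton γ
      lift : (ClosedGain F ∪Γ singleton γ) ⊆Γ Y
      lift x (inj₁ x∈) = inj₁ (gen x∈)
      lift x (inj₂ x≈γ) = inj₂ x≈γ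
      ⟪F⁺⟫⊆ : ⟪ F ∪ ⁅ e ⁆ ⟫ ⊆Γ ⟨ Y ⟩
      ⟪F⁺⟫⊆ = ⟨⟩-least (λ x x∈ → ⟨⟩-mono lift x (closedGain⁺⊆ x x∈))

    -- The cycle closed by e in F closes in F′ with the same gain γ, and γ ∈ ⟪ F ∪ ⁅ e ⁆ ⟫.
    M-cycle-submodular : ∀ {F′} → F ⊆ F′ → (M (F′ ∪ ⁅ e ⁆) + M F) ≤ (M (F ∪ ⁅ e ⁆) + M F′)
    M-cycle-submodular {F′} F⊆F′ = begin
      μ ⟪ F′ ∪ ⁅ e ⁆ ⟫ + μ ⟪ F ⟫     ≤⟨ +-mono₂-≤ (monotone ⟪F′⁺⟫⊆) (monotone ⟪F⟫⊆) ⟩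
      μ ⟨ X ∪Γ Y ⟩ + μ (X ∩Γ Y)      ≈⟨ +-congʳ (generated (X ∪Γ Y) (ε , inj₂ unit)) ⟨
      μ (X ∪Γ Y) + μ (X ∩Γ Y)        ≤⟨ submodular X Y ⟩
      μ X + μ Y                      ∎
      where
      open AddEdge.Cycle F′ e (walk-mono F⊆F′ p) using ()
        renaming (closedGain⁺⊆ to closedGain′⁺⊆)
      X Y : SubsetΓ
      X = ⟪ F ∪ ⁅ e ⁆ ⟫
      Y = ⟪ F′ ⟫
      into : (ClosedGain F′ ∪Γ singleton γ) ⊆Γ (X ∪Γ Y)
      into x (inj₁ x∈)  = inj₂ (gen x∈)
      into x (inj₂ x≈γ) = inj₁ (resp (≈Γ-sym x≈γ) (gen (Cycle.γ∈closedGain⁺ p)))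
      ⟪F′⁺⟫⊆ : ⟪ F′ ∪ ⁅ e ⁆ ⟫ ⊆Γ ⟨ X ∪Γ Y ⟩
      ⟪F′⁺⟫⊆ = ⟨⟩-least (λ x x∈ → ⟨⟩-mono into x (closedGain′⁺⊆ x x∈))
      ⟪F⟫⊆ : ⟪ F ⟫ ⊆Γ (X ∩Γ Y)
      ⟪F⟫⊆ x x∈ = ⟪⟫-mono (p⊆p∪q ⁅ e ⁆) x x∈ , ⟪⟫-mono F⊆F′ x x∈

  Δℓ≥0 : ∀ F e → 0# ≤ Δℓ F e
  Δℓ≥0 F e with connected F (tail e) (head e) in ends
  ... | true  = ≤-trans (ΔM≥0 F e) (≤-reflexive (sym (Δℓ-cycle F e ends)))
  ... | false = ≤-trans 0≤1 (≤-reflexive (sym (Δℓ-bridge F e ends)))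

  Δℓ-antitone : (∀ x → μ (singleton x) ≤ 1#) → ∀ A B e → A ⊆ B → Δℓ B e ≤ Δℓ A e
  Δℓ-antitone μ≤1 A B e A⊆B
    with connected A (tail e) (head e) in endsA | connected B (tail e) (head e) in endsB
  ... | true  | true  = begin
    Δℓ B e  ≈⟨ Δℓ-cycle B e endsB ⟩
    ΔM B e  ≤⟨ x+w≤z+y⇒x-y≤z-w (M-cycle-submodular (proj₂ (connected⇒walk endsA)) A⊆B) ⟩
    ΔM A e  ≈⟨ Δℓ-cycle A e endsA ⟨
    Δℓ A e  ∎
  ... | true  | false = ⊥-elim (FinBool.true≢false (connected-mono A⊆B endsA) endsB)
  ... | false | true  = begin
    Δℓ B e  ≈⟨ Δℓ-cycle B e endsB ⟩
    ΔM B e  ≤⟨ x≤y+z⇒x-y≤z (M-cycle-≤ (proj₂ (connected⇒walk endsB)) μ≤1) ⟩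
    1#      ≈⟨ Δℓ-bridge A e endsA ⟨
    Δℓ A e  ∎
  ... | false | false = ≤-reflexive (trans (Δℓ-bridge B e endsB) (sym (Δℓ-bridge A e endsA)))

theorem8p1 : (Γ : AbelianGroup 0ℓ 0ℓ) (R : OrderedCommutativeRing) (G : GainGraph Γ)
    (μ : GroupSubsets.SubsetΓ Γ → OrderedCommutativeRing.Carrier R) →
    Polymatroidal.IsSymmetricPolymatroidal Γ R μ →
    (∀ γ → OrderedCommutativeRing._≤_ R (μ (GroupSubsets.singleton Γ γ)) (OrderedCommutativeRing.1# R)) →
    (∀ (F F′ : Subset (GainGraph.m G)) → F ⊆ F′ →
    OrderedCommutativeRing._≤_ R (GainGraphFunctions.ℓ G R μ F) (GainGraphFunctions.ℓ G R μ F′))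
    × (∀ (F F′ : Subset (GainGraph.m G)) →
    OrderedCommutativeRing._≤_ R
    (OrderedCommutativeRing._+_ R (GainGraphFunctions.ℓ G R μ (F ∪ F′)) (GainGraphFunctions.ℓ G R μ (F ∩ F′)))
    (OrderedCommutativeRing._+_ R (GainGraphFunctions.ℓ G R μ F) (GainGraphFunctions.ℓ G R μ F′)))
theorem8p1 Γ R G μ μ-polymatroidal μ≤1 =
  monotone-by-Δ Δℓ≥0 , submodular-by-Δ (Δℓ-antitone μ≤1)
  where
  open Marginals R G μ μ-polymatroidal using (Δℓ≥0; Δℓ-antitone)
  open SetFunction R (GainGraphFunctions.ℓ G R μ) using (monotone-by-Δ; submodular-by-Δ)
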